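{- Let $\pi$ be a permutation of $[n]$ containing exactly one occurrence of the pattern $321$, with letters $c>b>a$ (appearing in the order $c,b,a$). Then the set of letters preceding $b$ in $\pi$ is $(\{c\}\cup[b-1])\setminus\{a\}$, a set of $b-1$ letters; consequently $b$ is a fixed point of $\pi$, i.e. $\pi_b=b$.
   Context: A permutation of $[n]$ is a word $\pi_1\cdots\pi_n$. An occurrence of $321$ is a triple of positions $i<j<k$ with $\pi_i>\pi_j>\pi_k$. $[m]=\{1,\dots,m\}$. -}

module Defs where

open import Data.Nat using (ℕ; suc; _<_)
open import Data.Fin using (Fin; toℕ)
open import Data.Fin.Base using () renaming (_<_ to _<ᶠ_)
open import Data.Product using (_×_; Σ; ∃-syntax)
open import Relation.Binary.PropositionalEquality using (_≡_)
open import Function.Definitions using (Injective)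

-- Positions are indexed by Fin n (position p stands for the 1-based position toℕ p + 1);
-- the letter at position p is  letter π p = toℕ (π p) + 1 ∈ [n] = {1,…,n}.
-- An injective self-map of Fin n is a bijection.
record Perm (n : ℕ) : Set where
  field
    fun : Fin n → Fin n
    inj : Injective _≡_ _≡_ fun
open Perm public

letter : ∀ {n} → Perm n → Fin n → ℕ
letter π p = suc (toℕ (fun π p))

Occ321 : ∀ {n} → Perm n → Fin n → Fin n → Fin n → Set
Occ321 π i j k =
  (i <ᶠ j) × (j <ᶠ k) × (letter π j < letter π i) × (letter π k < letter π j)

UniqueOcc321At : ∀ {n} → Perm n → Fin n → Fin n → Fin n → Set
UniqueOcc321At π i j k =
  Occ321 π i j k ×
  (∀ i′ j′ k′ → Occ321 π i′ j′ k′ → (i′ ≡ i) × (j′ ≡ j) × (k′ ≡ k))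

Precedes : ∀ {n} → Perm n → ℕ → Fin n → Set
Precedes π x j = ∃[ p ] ((p <ᶠ j) × (letter π p ≡ x))

-- Uniqueness of the occurrence c b a (at positions i < j < k) pins down every
-- comparison with b: a position p ∉ {i, k} lies before b exactly when its letter
-- is smaller than b, for otherwise (p, j, k) or (i, j, p) would be a second
-- occurrence.  Precomposing π with the
-- transposition of the positions i and k yields a bijection carrying the
-- positions before b exactly onto the letters below b, so both sets have the
-- same size, i.e. b sits at position b.
module Submission where

open import Defs
open import Data.Nat using (ℕ; _<_; _∸_; _≤_; zero; suc; z≤n; s≤s; s<s⁻¹)
open import Data.Nat.Properties using (1+n≰n; suc-injective)
import Data.Nat.Properties as ℕ
open import Data.Fin using (Fin; Fin′; toℕ; fromℕ<; inject; punchOut; _≟_)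
open import Data.Fin.Base using () renaming (_<_ to _<ᶠ_; _≤_ to _≤ᶠ_)
open import Data.Fin.Properties
  using (toℕ-injective; toℕ-fromℕ<; fromℕ<-injective; toℕ-inject; toℕ<n; any?;
         punchOut-injective; injective⇒≤; ≤-antisym; <-cmp; <-asym; <-irrefl)
open import Data.Fin.Permutation.Components using (transpose; transpose-inverse)
open import Data.Product using (_×_; _,_; proj₁; proj₂)
open import Data.Sum using (_⊎_; inj₁; inj₂)
open import Function.Base using (_∘_; const)
open import Function.Bundles using (_⇔_; mk⇔; Equivalence)
open import Function.Definitions using (Injective; StrictlySurjective)
open import Relation.Binary.Definitions using (tri<; tri≈; tri>)
open import Relation.Binary.PropositionalEquality
  using (_≡_; _≢_; refl; sym; trans; cong; subst)
open import Relation.Nullary using (¬_; Dec; yes; no; contradiction)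
open import Relation.Nullary.Decidable using (dec-true; dec-false)

open Equivalence using (to; from)

injective⇒strictlySurjective : ∀ {n} {f : Fin n → Fin n} →
  Injective _≡_ _≡_ f → StrictlySurjective _≡_ f
injective⇒strictlySurjective {zero} _ ()
injective⇒strictlySurjective {suc n} {f} f-inj y with any? (λ x → f x ≟ y)
... | yes hit = hit
... | no miss = contradiction (injective⇒≤ punched-inj) 1+n≰n
  where
  y≢f : ∀ x → y ≢ f x
  y≢f x y≡fx = miss (x , sym y≡fx)

  punched-inj : Injective _≡_ _≡_ (λ x → punchOut (y≢f x))
  punched-inj {x} {x′} = f-inj ∘ punchOut-injective (y≢f x) (y≢f x′)

segment-into-segment⇒≤ : ∀ {n} {ρ : Fin n → Fin n} {j c : Fin n} → Injective _≡_ _≡_ ρ →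
  (∀ p → p <ᶠ j → ρ p <ᶠ c) → j ≤ᶠ c
segment-into-segment⇒≤ {ρ = ρ} {j} {c} ρ-inj maps = injective⇒≤ restricted-inj
  where
  inject<j : (q : Fin′ j) → inject q <ᶠ j
  inject<j q = subst (_< toℕ j) (sym (toℕ-inject q)) (toℕ<n q)

  restricted : Fin′ j → Fin′ c
  restricted q = fromℕ< (maps (inject q) (inject<j q))

  inject-injective : ∀ {q q′ : Fin′ j} → inject q ≡ inject q′ → q ≡ q′
  inject-injective {q} {q′} e =
    toℕ-injective (trans (sym (toℕ-inject q)) (trans (cong toℕ e) (toℕ-inject q′)))

  restricted-inj : Injective _≡_ _≡_ restricted
  restricted-inj = inject-injective ∘ ρ-inj ∘ toℕ-injective ∘ fromℕ<-injective _ _ _ _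

segment-onto-segment⇒≡ : ∀ {n} {ρ : Fin n → Fin n} {j c : Fin n} → Injective _≡_ _≡_ ρ →
  (∀ p → p <ᶠ j ⇔ ρ p <ᶠ c) → j ≡ c
segment-onto-segment⇒≡ {ρ = ρ} {j} {c} ρ-inj segment =
  ≤-antisym (segment-into-segment⇒≤ ρ-inj (to ∘ segment)) (segment-into-segment⇒≤ σ-inj σ-maps)
  where
  σ : Fin _ → Fin _
  σ = proj₁ ∘ injective⇒strictlySurjective ρ-inj

  ρσ : ∀ y → ρ (σ y) ≡ y
  ρσ = proj₂ ∘ injective⇒strictlySurjective ρ-inj

  σ-inj : Injective _≡_ _≡_ σ
  σ-inj {y} {y′} e = trans (sym (ρσ y)) (trans (cong ρ e) (ρσ y′))

  σ-maps : ∀ y → y <ᶠ c → σ y <ᶠ j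
  σ-maps y y<c = from (segment (σ y)) (subst (_<ᶠ c) (sym (ρσ y)) y<c)

transpose-matchˡ : ∀ {n} (a b : Fin n) → transpose a b a ≡ b
transpose-matchˡ a b rewrite dec-true (a ≟ a) refl = refl

transpose-matchʳ : ∀ {n} (a b : Fin n) → transpose a b b ≡ a
transpose-matchʳ a b with b ≟ a
... | yes b≡a = b≡a
... | no _ rewrite dec-true (b ≟ b) refl = refl

transpose-mismatch : ∀ {n} {a b x : Fin n} → x ≢ a → x ≢ b → transpose a b x ≡ x
transpose-mismatch {a = a} {b} {x} x≢a x≢b
  rewrite dec-false (x ≟ a) x≢a | dec-false (x ≟ b) x≢b = refl

transpose-injective : ∀ {n} (a b : Fin n) → Injective _≡_ _≡_ (transpose a b)
transpose-injective a b e =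
  trans (sym (transpose-inverse b a)) (trans (cong (transpose b a) e) (transpose-inverse b a))

module UniqueOcc321 {n} (π : Perm n) (i j k : Fin n) (occ : UniqueOcc321At π i j k) where

  private
    i<j : i <ᶠ j
    i<j = proj₁ (proj₁ occ)

    j<k : j <ᶠ k
    j<k = proj₁ (proj₂ (proj₁ occ))

    πj<πi : fun π j <ᶠ fun π i
    πj<πi = s<s⁻¹ (proj₁ (proj₂ (proj₂ (proj₁ occ))))

    πk<πj : fun π k <ᶠ fun π j
    πk<πj = s<s⁻¹ (proj₂ (proj₂ (proj₂ (proj₁ occ))))

  larger-before⇒≡i : ∀ {p} → p <ᶠ j → fun π j <ᶠ fun π p → p ≡ i
  larger-before⇒≡i {p} p<j πj<πp = proj₁ (proj₂ occ p j k (p<j , j<k , s≤s πj<πp , s≤s πk<πj))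

  smaller-after⇒≡k : ∀ {p} → j <ᶠ p → fun π p <ᶠ fun π j → p ≡ k
  smaller-after⇒≡k {p} j<p πp<πj =
    proj₂ (proj₂ (proj₂ occ i j p (i<j , j<p , s≤s πj<πi , s≤s πp<πj)))

  before⇔smaller : ∀ {p} → p ≢ i → p ≢ k → p <ᶠ j ⇔ fun π p <ᶠ fun π j
  before⇔smaller {p} p≢i p≢k = mk⇔ before⇒smaller smaller⇒before
    where
    before⇒smaller : p <ᶠ j → fun π p <ᶠ fun π j
    before⇒smaller p<j with <-cmp (fun π p) (fun π j)
    ... | tri< πp<πj _ _ = πp<πj
    ... | tri≈ _ πp≡πj _ = contradiction (inj π πp≡πj) (λ { refl → <-irrefl refl p<j })
    ... | tri> _ _ πj<πp = contradiction (larger-before⇒≡i p<j πj<πp) p≢i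

    smaller⇒before : fun π p <ᶠ fun π j → p <ᶠ j
    smaller⇒before πp<πj with <-cmp p j
    ... | tri< p<j _ _ = p<j
    ... | tri≈ _ refl _ = contradiction πp<πj (<-irrefl refl)
    ... | tri> _ _ j<p = contradiction (smaller-after⇒≡k j<p πp<πj) p≢k

  before-j⇒≢k : ∀ {p} → p <ᶠ j → p ≢ k
  before-j⇒≢k p<j refl = <-asym p<j j<k

  precedes⇔ : ∀ x → Precedes π x j ⇔
    (((x ≡ letter π i) ⊎ (1 ≤ x × x < letter π j)) × ¬ (x ≡ letter π k))
  precedes⇔ x = mk⇔ (precedes⇒ x) (⇒precedes x)
    where
    letter-injective : ∀ {p q} → letter π p ≡ letter π q → p ≡ q
    letter-injective = inj π ∘ toℕ-injective ∘ suc-injective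

    precedes⇒ : ∀ x → Precedes π x j →
      ((x ≡ letter π i) ⊎ (1 ≤ x × x < letter π j)) × ¬ (x ≡ letter π k)
    precedes⇒ _ (p , p<j , refl) = position , before-j⇒≢k p<j ∘ letter-injective
      where
      position : (letter π p ≡ letter π i) ⊎ (1 ≤ letter π p × letter π p < letter π j)
      position with p ≟ i
      ... | yes refl = inj₁ refl
      ... | no p≢i = inj₂ (s≤s z≤n , s≤s (to (before⇔smaller p≢i (before-j⇒≢k p<j)) p<j))

    ⇒precedes : ∀ x → ((x ≡ letter π i) ⊎ (1 ≤ x × x < letter π j)) × ¬ (x ≡ letter π k) →
      Precedes π x j
    ⇒precedes _ (inj₁ refl , _) = i , i<j , refl
    ⇒precedes zero (inj₂ (() , _) , _)
    ⇒precedes (suc y) (inj₂ (_ , s≤s y<πj) , x≢πk) = p , p<j , cong suc πp≡y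
      where
      y<n : y < n
      y<n = ℕ.<-trans y<πj (toℕ<n (fun π j))

      p : Fin n
      p = proj₁ (injective⇒strictlySurjective (inj π) (fromℕ< y<n))

      πp≡y : toℕ (fun π p) ≡ y
      πp≡y = trans (cong toℕ (proj₂ (injective⇒strictlySurjective (inj π) (fromℕ< y<n))))
                   (toℕ-fromℕ< y<n)

      πp<πj : fun π p <ᶠ fun π j
      πp<πj = subst (_< toℕ (fun π j)) (sym πp≡y) y<πj

      p≢i : p ≢ i
      p≢i refl = <-asym πj<πi πp<πj

      p≢k : p ≢ k
      p≢k refl = x≢πk (cong suc (sym πp≡y))

      p<j : p <ᶠ j
      p<j = from (before⇔smaller p≢i p≢k) πp<πj

  segment⇔smaller-transposed : ∀ p → p <ᶠ j ⇔ fun π (transpose i k p) <ᶠ fun π j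
  segment⇔smaller-transposed p = by-cases (p ≟ i) (p ≟ k)
    where
    by-cases : Dec (p ≡ i) → Dec (p ≡ k) → p <ᶠ j ⇔ fun π (transpose i k p) <ᶠ fun π j
    by-cases (yes refl) _ rewrite transpose-matchˡ i k = mk⇔ (const πk<πj) (const i<j)
    by-cases (no _) (yes refl) rewrite transpose-matchʳ i k =
      mk⇔ (λ k<j → contradiction j<k (<-asym k<j)) (λ πi<πj → contradiction πj<πi (<-asym πi<πj))
    by-cases (no p≢i) (no p≢k) rewrite transpose-mismatch p≢i p≢k = before⇔smaller p≢i p≢k

  fixed-point : j ≡ fun π j
  fixed-point = segment-onto-segment⇒≡
    (λ e → transpose-injective i k (inj π e)) segment⇔smaller-transposed

lemma21 : ∀ {n} (π : Perm n) (i j k : Fin n) → UniqueOcc321At π i j k →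
    (∀ (x : ℕ) → Precedes π x j ⇔
        (((x ≡ letter π i) ⊎ (1 ≤ x × x < letter π j)) × ¬ (x ≡ letter π k)))
    × (toℕ j ≡ letter π j ∸ 1)
    × (fun π j ≡ j)
lemma21 π i j k occ = precedes⇔ , cong toℕ fixed-point , sym fixed-point
  where open UniqueOcc321 π i j k occ
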